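{- Let $\vec U$ be a universe of separations. Then the following are equivalent: (i) $\vec s\le\vec t^{\,*}$ for all small $\vec s,\vec t\in\vec U$; (ii) $\vec s\vee\vec t$ is small for all small $\vec s,\vec t\in\vec U$; (iii) $\vec s\wedge\vec t$ is co-small for all co-small $\vec s,\vec t\in\vec U$.
   Context: A separation system is a poset together with an order-reversing involution $\vec s\mapsto\vec s^{\,*}$. A universe of separations is a separation system which is a lattice (every two elements $\vec s,\vec t$ have a join $\vec s\vee\vec t$ and a meet $\vec s\wedge\vec t$). An element $\vec s$ is small if $\vec s\le\vec s^{\,*}$ and co-small if $\vec s^{\,*}\le\vec s$. -}

module Defs where

open import Level using (Level; suc; _⊔_)
open import Relation.Binary.Lattice.Bundles using (Lattice)

record Universe (c ℓ₁ ℓ₂ : Level) : Set (suc (c ⊔ ℓ₁ ⊔ ℓ₂)) where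
  field
    lattice : Lattice c ℓ₁ ℓ₂
  open Lattice lattice public
  field
    _*        : Carrier → Carrier
    *-involutive : ∀ s → (s *) * ≈ s
    *-reversing  : ∀ {s t} → s ≤ t → t * ≤ s *

  Small : Carrier → Set ℓ₂
  Small s = s ≤ s *

  CoSmall : Carrier → Set ℓ₂
  CoSmall s = s * ≤ s

-- The involution turns joins into meets: s * ∧ t * is the largest element
-- below both s * and t *, and s ∨ t ≤ (s ∨ t) * says exactly that s and t
-- both lie below s * ∧ t *.  This gives (i) ⇔ (ii).  Since * exchanges small
-- and co-small elements as well as joins and meets, (ii) and (iii) are
-- dual to each other.
module Submission where

open import Defs
open import Level using (_⊔_)
open import Data.Product using (_×_; _,_)
open import Function.Bundles using (_⇔_; mk⇔)
import Relation.Binary.Reasoning.PartialOrder as PosetReasoning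

module _ {c ℓ₁ ℓ₂} (U : Universe c ℓ₁ ℓ₂) where
  open Universe U
  open PosetReasoning poset

  *-swapʳ : ∀ {x y} → x ≤ y * → y ≤ x *
  *-swapʳ {x} {y} x≤y* = begin
    y        ≈˘⟨ *-involutive y ⟩
    (y *) *  ≤⟨ *-reversing x≤y* ⟩
    x *      ∎

  *-swapˡ : ∀ {x y} → x * ≤ y → y * ≤ x
  *-swapˡ {x} {y} x*≤y = begin
    y *      ≤⟨ *-reversing x*≤y ⟩
    (x *) *  ≈⟨ *-involutive x ⟩
    x        ∎

  ∨≤[*∧*]* : ∀ s t → s ∨ t ≤ (s * ∧ t *) *
  ∨≤[*∧*]* s t = ∨-least (*-swapʳ (x∧y≤x _ _)) (*-swapʳ (x∧y≤y _ _))

  [*∨*]*≤∧ : ∀ s t → (s * ∨ t *) * ≤ s ∧ t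
  [*∨*]*≤∧ s t = ∧-greatest (*-swapˡ (x≤x∨y _ _)) (*-swapˡ (y≤x∨y _ _))

  *∧*≤[∨]* : ∀ s t → s * ∧ t * ≤ (s ∨ t) *
  *∧*≤[∨]* s t = *-swapʳ (∨≤[*∧*]* s t)

  [∧]*≤*∨* : ∀ s t → (s ∧ t) * ≤ s * ∨ t *
  [∧]*≤*∨* s t = *-swapˡ ([*∨*]*≤∧ s t)

  Small⇒CoSmall* : ∀ {s} → Small s → CoSmall (s *)
  Small⇒CoSmall* {s} s≤s* = trans (reflexive (*-involutive s)) s≤s*

  CoSmall⇒Small* : ∀ {s} → CoSmall s → Small (s *)
  CoSmall⇒Small* {s} s*≤s = trans s*≤s (reflexive (Eq.sym (*-involutive s)))

  SmallsBelowDuals : Set (c ⊔ ℓ₂)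
  SmallsBelowDuals = ∀ s t → Small s → Small t → s ≤ t *

  Small-∨-closed : Set (c ⊔ ℓ₂)
  Small-∨-closed = ∀ s t → Small s → Small t → Small (s ∨ t)

  CoSmall-∧-closed : Set (c ⊔ ℓ₂)
  CoSmall-∧-closed = ∀ s t → CoSmall s → CoSmall t → CoSmall (s ∧ t)

  SmallsBelowDuals⇒Small-∨-closed : SmallsBelowDuals → Small-∨-closed
  SmallsBelowDuals⇒Small-∨-closed below s t s-small t-small = begin
    s ∨ t          ≤⟨ ∨-least (∧-greatest s-small (below s t s-small t-small))
                              (∧-greatest (below t s t-small s-small) t-small) ⟩
    s * ∧ t *      ≤⟨ *∧*≤[∨]* s t ⟩
    (s ∨ t) *      ∎

  Small-∨-closed⇒SmallsBelowDuals : Small-∨-closed → SmallsBelowDuals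
  Small-∨-closed⇒SmallsBelowDuals closed s t s-small t-small = begin
    s              ≤⟨ x≤x∨y s t ⟩
    s ∨ t          ≤⟨ closed s t s-small t-small ⟩
    (s ∨ t) *      ≤⟨ *-reversing (y≤x∨y s t) ⟩
    t *            ∎

  Small-∨-closed⇒CoSmall-∧-closed : Small-∨-closed → CoSmall-∧-closed
  Small-∨-closed⇒CoSmall-∧-closed closed s t s-cosmall t-cosmall = begin
    (s ∧ t) *      ≤⟨ [∧]*≤*∨* s t ⟩
    s * ∨ t *      ≤⟨ closed (s *) (t *) (CoSmall⇒Small* s-cosmall) (CoSmall⇒Small* t-cosmall) ⟩
    (s * ∨ t *) *  ≤⟨ [*∨*]*≤∧ s t ⟩
    s ∧ t          ∎

  CoSmall-∧-closed⇒Small-∨-closed : CoSmall-∧-closed → Small-∨-closed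
  CoSmall-∧-closed⇒Small-∨-closed closed s t s-small t-small = begin
    s ∨ t          ≤⟨ ∨≤[*∧*]* s t ⟩
    (s * ∧ t *) *  ≤⟨ closed (s *) (t *) (Small⇒CoSmall* s-small) (Small⇒CoSmall* t-small) ⟩
    s * ∧ t *      ≤⟨ *∧*≤[∨]* s t ⟩
    (s ∨ t) *      ∎

lemma3p4 : ∀ {c ℓ₁ ℓ₂} (U : Universe c ℓ₁ ℓ₂) → let open Universe U in
    ((∀ s t → Small s → Small t → s ≤ t *) ⇔ (∀ s t → Small s → Small t → Small (s ∨ t)))
    × ((∀ s t → Small s → Small t → Small (s ∨ t)) ⇔ (∀ s t → CoSmall s → CoSmall t → CoSmall (s ∧ t)))
lemma3p4 U =
  mk⇔ (SmallsBelowDuals⇒Small-∨-closed U) (Small-∨-closed⇒SmallsBelowDuals U) ,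
  mk⇔ (Small-∨-closed⇒CoSmall-∧-closed U) (CoSmall-∧-closed⇒Small-∨-closed U)
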